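{- Let $\Gamma=(V,E)$ be a finite simple graph with an acyclic orientation and clique number at least $3$, let $W=\mathbb{R}^n$ (resp. $\mathbb{C}^n$) with the standard inner product, $G=\mathrm{O}(n)$ (resp. $\mathrm{U}(n)$), $\rho:G\to\mathrm{GL}(W)$ an orthogonal (resp. unitary) representation, and $A$ a connection with curvature $F$. Then $\langle d_A(\delta A),F\rangle=0$ for every $\mathrm{End}(W)$-valued $1$-form $\delta A$ satisfying $\delta A(j,i)=-\rho(A(j,i))\,\delta A(i,j)\,\rho(A(j,i))$ for all $\{i,j\}\in E$ (i.e. the first variation of $\mathcal{YM}_\rho(A)=\frac12\langle F,F\rangle$ vanishes) if and only if $$d_A^*F(i,j)=\rho(A(i,j))\,d_A^*F(j,i)\,\rho(A(i,j))\quad\text{for all ordered pairs }(i,j)\text{ with }\{i,j\}\in E.$$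
   Context: A $k$-clique is a $k$-subset of $V$ of pairwise adjacent vertices; $i<j$ iff there is a directed path from $i$ to $j$. A connection is a map $A$ on ordered pairs $(i,j)$ with $\{i,j\}\in E$, $A(i,j)\in G$, $A(j,i)=A(i,j)^{ -1}$. An $\mathrm{End}(W)$-valued $k$-form is a map $V^{k+1}\to\mathrm{End}(W)$ vanishing on tuples whose entries do not form a $(k+1)$-clique. The curvature is $F(i,j,k)=\rho(A(i,j)A(j,k))-\rho(A(i,k))$ on triples forming a $3$-clique, zero otherwise. For an $\mathrm{End}(W)$-valued $k$-form $\varphi$, $d_A\varphi$ is given on tuples forming a $(k+2)$-clique by $(d_A\varphi)(i_0,\dots,i_{k+1})=\rho(A(i_0,i_1))\varphi(i_1,\dots,i_{k+1})+\sum_{j=1}^{k}(-1)^j\varphi(i_0,\dots,\widehat{i_j},\dots,i_{k+1})+(-1)^{k+1}\varphi(i_0,\dots,i_k)\rho(A(i_k,i_{k+1}))$, and zero elsewhere. The inner product on $\mathrm{End}(W)$-valued $k$-forms is $\langle\varphi_1,\varphi_2\rangle=\frac{1}{(k+1)!}\sum_{(i_0,\dots,i_k)\in V^{k+1}}\mathrm{Tr}(\varphi_1(i_0,\dots,i_k)\varphi_2(i_0,\dots,i_k)^\dagger)$, with $^\dagger$ the adjoint for the standard inner product, and $d_A^*$ is the adjoint of $d_A$ (from $1$-forms to $2$-forms) with respect to it. -}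

module Defs where

open import Data.Nat using (ℕ; zero; suc)
open import Data.Fin using (Fin; zero; suc; _≟_)
open import Data.Bool using (Bool; true; false; if_then_else_; _∧_)
open import Data.Product using (Σ; ∃; _×_; _,_)
open import Data.Sum using (_⊎_)
open import Relation.Nullary using (¬_; yes; no)
open import Relation.Binary.PropositionalEquality using (_≡_; _≢_)
open import Algebra.Structures using (IsCommutativeRing)
open import Relation.Binary.Structures using (IsStrictTotalOrder)

-- The real numbers, axiomatised as a complete ordered field
-- (any model is isomorphic to ℝ).  The inverse is total with inv 0 = 0.

record RealField : Set₁ where
  infixl 6 _+_
  infixl 7 _*_
  infix 4 _<_
  field
    ℝ     : Set
    _+_ _*_ : ℝ → ℝ → ℝ
    -_    : ℝ → ℝ
    0ℝ 1ℝ : ℝ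
    inv   : ℝ → ℝ
    _<_   : ℝ → ℝ → Set
    isCommutativeRing  : IsCommutativeRing _≡_ _+_ _*_ -_ 0ℝ 1ℝ
    0≢1                : 0ℝ ≢ 1ℝ
    inv-inverse        : ∀ x → x ≢ 0ℝ → x * inv x ≡ 1ℝ
    inv-0              : inv 0ℝ ≡ 0ℝ
    isStrictTotalOrder : IsStrictTotalOrder _≡_ _<_
    +-mono-<           : ∀ {x y} z → x < y → x + z < y + z
    *-pos              : ∀ {x y} → 0ℝ < x → 0ℝ < y → 0ℝ < x * y
    complete : (P : ℝ → Set) → ∃ P → (∃ λ b → ∀ x → P x → ¬ (b < x)) →
               ∃ λ s → (∀ x → P x → ¬ (s < x)) ×
                       (∀ b → (∀ x → P x → ¬ (b < x)) → ¬ (b < s))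

record Scalars : Set₁ where
  infixl 6 _+_
  infixl 7 _*_
  field
    K       : Set
    0# 1#   : K
    _+_ _*_ : K → K → K
    -_      : K → K
    conj    : K → K
    inv     : K → K

data Kind : Set where
  real complex : Kind

realScalars : RealField → Scalars
realScalars R = record
  { K = ℝ ; 0# = 0ℝ ; 1# = 1ℝ ; _+_ = _+_ ; _*_ = _*_ ; -_ = -_
  ; conj = λ x → x ; inv = inv }
  where open RealField R

complexScalars : RealField → Scalars
complexScalars R = record
  { K = ℝ × ℝ
  ; 0# = (0ℝ , 0ℝ)
  ; 1# = (1ℝ , 0ℝ)
  ; _+_ = λ { (a , b) (c , d) → (a + c , b + d) }
  ; _*_ = λ { (a , b) (c , d) → (a * c + - (b * d) , a * d + b * c) }
  ; -_ = λ { (a , b) → (- a , - b) }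
  ; conj = λ { (a , b) → (a , - b) }
  ; inv = λ { (a , b) → (a * inv (a * a + b * b) , - (b * inv (a * a + b * b))) }
  }
  where open RealField R

scalars : RealField → Kind → Scalars
scalars R real    = realScalars R
scalars R complex = complexScalars R

record Graph (N : ℕ) : Set where
  field
    adj        : Fin N → Fin N → Bool
    adj-sym    : ∀ i j → adj i j ≡ adj j i
    adj-irrefl : ∀ i → adj i i ≡ false

module GraphNotions {N : ℕ} (Γ : Graph N) where
  open Graph Γ

  Edge : Fin N → Fin N → Set
  Edge i j = adj i j ≡ true

  -- (i, j, k) forms a 3-clique (pairwise adjacent, hence distinct)
  tri : Fin N → Fin N → Fin N → Bool
  tri i j k = adj i j ∧ adj j k ∧ adj i k

  CliqueNumber≥3 : Set
  CliqueNumber≥3 = ∃ λ i → ∃ λ j → ∃ λ k → tri i j k ≡ true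

  data Path (dir : Fin N → Fin N → Bool) : Fin N → Fin N → Set where
    step : ∀ {i j} → dir i j ≡ true → Path dir i j
    _∷_  : ∀ {i j k} → dir i j ≡ true → Path dir j k → Path dir i k

  record AcyclicOrientation : Set where
    field
      dir         : Fin N → Fin N → Bool
      dir-edge    : ∀ i j → dir i j ≡ true → Edge i j
      dir-total   : ∀ i j → Edge i j → dir i j ≡ true ⊎ dir j i ≡ true
      dir-antisym : ∀ i j → dir i j ≡ true → dir j i ≡ false
      acyclic     : ∀ i → ¬ Path dir i i

module LinAlg (S : Scalars) (n : ℕ) where
  open Scalars S

  Mat : Set
  Mat = Fin n → Fin n → K

  sumFin : ∀ {m} → (Fin m → K) → K
  sumFin {zero}  f = 0#
  sumFin {suc m} f = f zero + sumFin (λ i → f (suc i))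

  infixl 7 _*ᴹ_
  infixl 6 _+ᴹ_ _-ᴹ_
  infix 4 _≈ᴹ_

  _*ᴹ_ : Mat → Mat → Mat
  (M *ᴹ P) a b = sumFin (λ c → M a c * P c b)

  _+ᴹ_ : Mat → Mat → Mat
  (M +ᴹ P) a b = M a b + P a b

  -ᴹ_ : Mat → Mat
  (-ᴹ M) a b = - M a b

  _-ᴹ_ : Mat → Mat → Mat
  M -ᴹ P = M +ᴹ (-ᴹ P)

  𝟎ᴹ : Mat
  𝟎ᴹ a b = 0#

  𝟏ᴹ : Mat
  𝟏ᴹ a b with a ≟ b
  ... | yes _ = 1#
  ... | no  _ = 0#

  _† : Mat → Mat
  (M †) a b = conj (M b a)

  tr : Mat → K
  tr M = sumFin (λ a → M a a)

  _≈ᴹ_ : Mat → Mat → Set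
  M ≈ᴹ P = ∀ a b → M a b ≡ P a b

  -- membership in G = O(n) (real case) resp. U(n) (complex case)
  InG : Mat → Set
  InG M = (M *ᴹ M †) ≈ᴹ 𝟏ᴹ × (M † *ᴹ M) ≈ᴹ 𝟏ᴹ

  -- an orthogonal/unitary representation ρ : G → GL(W); only the
  -- values of ρ on G matter
  record Representation : Set where
    field
      ρ         : Mat → Mat
      ρ-wd      : ∀ {g h} → InG g → g ≈ᴹ h → ρ g ≈ᴹ ρ h
      ρ-id      : ρ 𝟏ᴹ ≈ᴹ 𝟏ᴹ
      ρ-hom     : ∀ {g h} → InG g → InG h → ρ (g *ᴹ h) ≈ᴹ ρ g *ᴹ ρ h
      ρ-unitary : ∀ {g} → InG g → InG (ρ g)

module Forms (S : Scalars) (n : ℕ) {N : ℕ} (Γ : Graph N) where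
  open Scalars S
  open LinAlg S n
  open Graph Γ
  open GraphNotions Γ

  record Connection : Set where
    field
      A     : Fin N → Fin N → Mat
      A-G   : ∀ i j → Edge i j → InG (A i j)
      A-inv : ∀ i j → Edge i j → A i j *ᴹ A j i ≈ᴹ 𝟏ᴹ

  OneForm : Set
  OneForm = Fin N → Fin N → Mat

  TwoForm : Set
  TwoForm = Fin N → Fin N → Fin N → Mat

  Is1Form : OneForm → Set
  Is1Form φ = ∀ i j → adj i j ≡ false → φ i j ≈ᴹ 𝟎ᴹ

  Is2Form : TwoForm → Set
  Is2Form ψ = ∀ i j k → tri i j k ≡ false → ψ i j k ≈ᴹ 𝟎ᴹ

  two six : K
  two = 1# + 1#
  six = two + two + two

  ⟨_,_⟩₁ : OneForm → OneForm → K
  ⟨ φ₁ , φ₂ ⟩₁ = inv two * sumFin (λ i → sumFin (λ j → tr (φ₁ i j *ᴹ φ₂ i j †)))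

  ⟨_,_⟩₂ : TwoForm → TwoForm → K
  ⟨ ψ₁ , ψ₂ ⟩₂ = inv six * sumFin (λ i → sumFin (λ j → sumFin (λ k →
                   tr (ψ₁ i j k *ᴹ ψ₂ i j k †))))

  module _ (R : Representation) (C : Connection) where
    open Representation R
    open Connection C

    curvature : TwoForm
    curvature i j k =
      if tri i j k then ρ (A i j *ᴹ A j k) -ᴹ ρ (A i k) else 𝟎ᴹ

    d-A : OneForm → TwoForm
    d-A φ i j k =
      if tri i j k
      then ρ (A i j) *ᴹ φ j k -ᴹ φ i k +ᴹ φ i j *ᴹ ρ (A j k)
      else 𝟎ᴹ

    IsAdjointOfd-A : (TwoForm → OneForm) → Set
    IsAdjointOfd-A D =
      (∀ ψ → Is2Form ψ → Is1Form (D ψ)) ×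
      (∀ φ ψ → Is1Form φ → Is2Form ψ → ⟨ d-A φ , ψ ⟩₂ ≡ ⟨ φ , D ψ ⟩₁)

    IsVariation : OneForm → Set
    IsVariation δA = Is1Form δA ×
      (∀ i j → Edge i j → δA j i ≈ᴹ -ᴹ (ρ (A j i) *ᴹ δA i j *ᴹ ρ (A j i)))

    FirstVariationVanishes : Set
    FirstVariationVanishes =
      ∀ δA → IsVariation δA → ⟨ d-A δA , curvature ⟩₂ ≡ 0#

    YangMillsCondition : (TwoForm → OneForm) → Set
    YangMillsCondition D = ∀ i j → Edge i j →
      D curvature i j ≈ᴹ ρ (A i j) *ᴹ D curvature j i *ᴹ ρ (A i j)

module Submission where

-- Write ⟪ M , P ⟫ = tr (M P†). By adjointness ⟨ d_A δA , F ⟩ = ½ Σ_{i,j} ⟪ δA(i,j) , d_A*F(i,j) ⟫.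
-- Since g = ρ(A(i,j)) is unitary with inverse ρ(A(j,i)), the constraint on δA turns the
-- (j,i)-term into − ⟪ δA(i,j) , g d_A*F(j,i) g ⟫, so under the Yang–Mills symmetry the terms
-- cancel in pairs. Conversely, testing against the variation supported on the edge {i,j} with
-- δA(i,j) = Y := d_A*F(i,j) − g d_A*F(j,i) g gives ½ ⟪ Y , Y ⟫ = 0, hence Y = 0.

open import Defs
open import Data.Nat using (ℕ; zero; suc)
open import Data.Fin using (Fin; zero; suc; _≟_)
open import Data.Fin.Properties using (suc-injective)
open import Data.Bool using (true; false)
open import Data.Empty using (⊥-elim)
open import Data.Sum using (_⊎_; inj₁; inj₂)
open import Data.Product using (_×_; _,_; proj₁; proj₂; swap)
open import Function using (_∘_)
open import Relation.Nullary using (¬_; Dec; yes; no)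
open import Relation.Nullary.Decidable using (_×-dec_)
open import Relation.Binary.PropositionalEquality
open import Relation.Binary.Bundles using (Setoid)
open import Relation.Binary.Definitions using (tri<; tri≈; tri>)
open import Relation.Binary.Structures using (IsStrictTotalOrder)
open import Algebra.Bundles using (CommutativeRing)
open import Algebra.Structures using (IsCommutativeRing)
import Algebra.Properties.Ring as RingProperties
import Algebra.Properties.CommutativeSemigroup as CommutativeSemigroupProperties
import Algebra.Properties.CommutativeMonoid.Sum as MonoidSum
import Algebra.Properties.Semiring.Sum as SemiringSum
import Relation.Binary.Reasoning.Setoid as SetoidReasoning

record IsPositiveStarRing (S : Scalars) : Set₁ where
  open Scalars S
  field
    isCommutativeRing : IsCommutativeRing _≡_ _+_ _*_ -_ 0# 1#
    conj-+            : ∀ x y → conj (x + y) ≡ conj x + conj y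
    conj-*            : ∀ x y → conj (x * y) ≡ conj x * conj y
    conj-1            : conj 1# ≡ 1#
    inv-2             : inv (1# + 1#) * (1# + 1#) ≡ 1#
    NonNeg            : K → Set
    NonNeg-+          : ∀ {x y} → NonNeg x → NonNeg y → NonNeg (x + y)
    NonNeg-norm       : ∀ x → NonNeg (x * conj x)
    NonNeg-+-zeroˡ    : ∀ {x y} → NonNeg x → NonNeg y → x + y ≡ 0# → x ≡ 0#
    norm-zero         : ∀ x → x * conj x ≡ 0# → x ≡ 0#

module StarRingProperties {S : Scalars} (P : IsPositiveStarRing S) where
  open Scalars S
  open IsPositiveStarRing P public

  commutativeRing : CommutativeRing _ _
  commutativeRing = record { isCommutativeRing = isCommutativeRing }

  open CommutativeRing commutativeRing public
    using ( ring; semiring; +-commutativeMonoid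
          ; +-comm; +-identityˡ; +-identityʳ; -‿inverseˡ; -‿inverseʳ
          ; *-assoc; *-comm; *-identityˡ; *-identityʳ; distribʳ; zeroˡ; zeroʳ )
  open RingProperties ring public
    using ( -‿distribˡ-*; -‿distribʳ-*; -0#≈0#; -‿involutive; -1*x≈-x
          ; x∙y⁻¹≈ε⇒x≈y; +-identityˡ-unique; +-inverseˡ-unique; x[y-z]≈xy-xz )
  open ≡-Reasoning

  conj-0 : conj 0# ≡ 0#
  conj-0 = +-identityˡ-unique (conj 0#) (conj 0#)
             (trans (sym (conj-+ 0# 0#)) (cong conj (+-identityˡ 0#)))

  conj-neg : ∀ x → conj (- x) ≡ - conj x
  conj-neg x = +-inverseˡ-unique (conj (- x)) (conj x)
                 (trans (sym (conj-+ (- x) x)) (trans (cong conj (-‿inverseˡ x)) conj-0))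

  NonNeg-0 : NonNeg 0#
  NonNeg-0 = subst NonNeg (zeroˡ (conj 0#)) (NonNeg-norm 0#)

  *-cancel-zeroˡ : ∀ {a b} x → b * a ≡ 1# → a * x ≡ 0# → x ≡ 0#
  *-cancel-zeroˡ {a} {b} x ba≡1 ax≡0 = begin
    x            ≡⟨ sym (*-identityˡ x) ⟩
    1# * x       ≡⟨ cong (_* x) (sym ba≡1) ⟩
    b * a * x    ≡⟨ *-assoc b a x ⟩
    b * (a * x)  ≡⟨ cong (b *_) ax≡0 ⟩
    b * 0#       ≡⟨ zeroʳ b ⟩
    0#           ∎

  half*x≡0⇒x≡0 : ∀ x → inv (1# + 1#) * x ≡ 0# → x ≡ 0#
  half*x≡0⇒x≡0 x = *-cancel-zeroˡ x (trans (*-comm _ _) inv-2)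

  x≡-x⇒x≡0 : ∀ x → x ≡ - x → x ≡ 0#
  x≡-x⇒x≡0 x x≡-x = *-cancel-zeroˡ x inv-2 (begin
    (1# + 1#) * x    ≡⟨ distribʳ x 1# 1# ⟩
    1# * x + 1# * x  ≡⟨ cong₂ _+_ (*-identityˡ x) (*-identityˡ x) ⟩
    x + x            ≡⟨ cong (x +_) x≡-x ⟩
    x + - x          ≡⟨ -‿inverseʳ x ⟩
    0#               ∎)

-- sumFin is declared inside LinAlg S n, so its properties are stated for a fixed n.
module FiniteSums {S : Scalars} (P : IsPositiveStarRing S) (n : ℕ) where
  open Scalars S
  open StarRingProperties P
  open LinAlg S n using (sumFin)
  open MonoidSum +-commutativeMonoid using (sum; sum-cong-≗; ∑-distrib-+; ∑-comm)
  open SemiringSum semiring using (*-distribˡ-sum)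

  sumFin≡sum : ∀ {m} (f : Fin m → K) → sumFin f ≡ sum f
  sumFin≡sum {zero}  f = refl
  sumFin≡sum {suc m} f = cong (f zero +_) (sumFin≡sum (λ i → f (suc i)))

  sumFin-cong : ∀ {m} {f g : Fin m → K} → (∀ i → f i ≡ g i) → sumFin f ≡ sumFin g
  sumFin-cong {f = f} {g} f≗g =
    trans (sumFin≡sum f) (trans (sum-cong-≗ f≗g) (sym (sumFin≡sum g)))

  sumFin-+ : ∀ {m} (f g : Fin m → K) → sumFin (λ i → f i + g i) ≡ sumFin f + sumFin g
  sumFin-+ f g = begin
    sumFin (λ i → f i + g i)  ≡⟨ sumFin≡sum (λ i → f i + g i) ⟩
    sum (λ i → f i + g i)     ≡⟨ ∑-distrib-+ f g ⟩
    sum f + sum g             ≡⟨ sym (cong₂ _+_ (sumFin≡sum f) (sumFin≡sum g)) ⟩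
    sumFin f + sumFin g       ∎
    where open ≡-Reasoning

  *-distribˡ-sumFin : ∀ {m} x (f : Fin m → K) → x * sumFin f ≡ sumFin (λ i → x * f i)
  *-distribˡ-sumFin x f = begin
    x * sumFin f              ≡⟨ cong (x *_) (sumFin≡sum f) ⟩
    x * sum f                 ≡⟨ *-distribˡ-sum x f ⟩
    sum (λ i → x * f i)       ≡⟨ sym (sumFin≡sum (λ i → x * f i)) ⟩
    sumFin (λ i → x * f i)    ∎
    where open ≡-Reasoning

  *-distribʳ-sumFin : ∀ {m} x (f : Fin m → K) → sumFin f * x ≡ sumFin (λ i → f i * x)
  *-distribʳ-sumFin x f =
    trans (*-comm _ x) (trans (*-distribˡ-sumFin x f) (sumFin-cong (λ i → *-comm x (f i))))

  sumFin-neg : ∀ {m} (f : Fin m → K) → sumFin (λ i → - f i) ≡ - sumFin f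
  sumFin-neg f = begin
    sumFin (λ i → - f i)       ≡⟨ sumFin-cong (λ i → sym (-1*x≈-x (f i))) ⟩
    sumFin (λ i → - 1# * f i)  ≡⟨ sym (*-distribˡ-sumFin (- 1#) f) ⟩
    - 1# * sumFin f            ≡⟨ -1*x≈-x _ ⟩
    - sumFin f                 ∎
    where open ≡-Reasoning

  sumFin-comm : ∀ {m p} (f : Fin m → Fin p → K) →
    sumFin (λ i → sumFin (λ j → f i j)) ≡ sumFin (λ j → sumFin (λ i → f i j))
  sumFin-comm f = begin
    sumFin (λ i → sumFin (λ j → f i j))  ≡⟨ sumFin²≡sum² f ⟩
    sum (λ i → sum (λ j → f i j))        ≡⟨ ∑-comm f ⟩
    sum (λ j → sum (λ i → f i j))        ≡⟨ sym (sumFin²≡sum² (λ j i → f i j)) ⟩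
    sumFin (λ j → sumFin (λ i → f i j))  ∎
    where
    open ≡-Reasoning
    sumFin²≡sum² : ∀ {m p} (g : Fin m → Fin p → K) →
      sumFin (λ i → sumFin (λ j → g i j)) ≡ sum (λ i → sum (λ j → g i j))
    sumFin²≡sum² g = trans (sumFin-cong (λ i → sumFin≡sum (g i))) (sumFin≡sum (λ i → sum (g i)))

  sumFin-zero : ∀ {m} {f : Fin m → K} → (∀ i → f i ≡ 0#) → sumFin f ≡ 0#
  sumFin-zero {zero}  f≗0 = refl
  sumFin-zero {suc m} f≗0 =
    trans (cong₂ _+_ (f≗0 zero) (sumFin-zero (λ i → f≗0 (suc i)))) (+-identityˡ 0#)

  sumFin-single : ∀ {m} {f : Fin m → K} (a : Fin m) → (∀ c → c ≢ a → f c ≡ 0#) → sumFin f ≡ f a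
  sumFin-single {suc m} {f} zero    f-off =
    trans (cong (f zero +_) (sumFin-zero (λ i → f-off (suc i) (λ ())))) (+-identityʳ _)
  sumFin-single {suc m} {f} (suc a) f-off =
    trans (cong₂ _+_ (f-off zero (λ ()))
                     (sumFin-single a (λ c c≢a → f-off (suc c) (c≢a ∘ suc-injective))))
          (+-identityˡ _)

  sumFin-conj : ∀ {m} (f : Fin m → K) → conj (sumFin f) ≡ sumFin (λ i → conj (f i))
  sumFin-conj {zero}  f = conj-0
  sumFin-conj {suc m} f = trans (conj-+ _ _) (cong (conj (f zero) +_) (sumFin-conj (λ i → f (suc i))))

  sumFin-NonNeg : ∀ {m} (f : Fin m → K) → (∀ i → NonNeg (f i)) → NonNeg (sumFin f)
  sumFin-NonNeg {zero}  f f≥0 = NonNeg-0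
  sumFin-NonNeg {suc m} f f≥0 = NonNeg-+ (f≥0 zero) (sumFin-NonNeg (λ i → f (suc i)) (λ i → f≥0 (suc i)))

  sumFin-NonNeg-zero : ∀ {m} (f : Fin m → K) → (∀ i → NonNeg (f i)) → sumFin f ≡ 0# → ∀ i → f i ≡ 0#
  sumFin-NonNeg-zero {suc m} f f≥0 Σ≡0 zero =
    NonNeg-+-zeroˡ (f≥0 zero) (sumFin-NonNeg _ (λ i → f≥0 (suc i))) Σ≡0
  sumFin-NonNeg-zero {suc m} f f≥0 Σ≡0 (suc i) =
    sumFin-NonNeg-zero (λ i → f (suc i)) (λ i → f≥0 (suc i))
      (NonNeg-+-zeroˡ (sumFin-NonNeg _ (λ i → f≥0 (suc i))) (f≥0 zero) (trans (+-comm _ _) Σ≡0)) i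

  sumFin²-+ : ∀ {m p} (f g : Fin m → Fin p → K) →
    sumFin (λ i → sumFin (λ j → f i j + g i j)) ≡
    sumFin (λ i → sumFin (λ j → f i j)) + sumFin (λ i → sumFin (λ j → g i j))
  sumFin²-+ f g = trans (sumFin-cong (λ i → sumFin-+ (f i) (g i)))
                        (sumFin-+ (λ i → sumFin (f i)) (λ i → sumFin (g i)))

  sumFin²-neg : ∀ {m p} (f : Fin m → Fin p → K) →
    sumFin (λ i → sumFin (λ j → - f i j)) ≡ - sumFin (λ i → sumFin (λ j → f i j))
  sumFin²-neg f = trans (sumFin-cong (λ i → sumFin-neg (f i))) (sumFin-neg (λ i → sumFin (f i)))

module Matrices {S : Scalars} (P : IsPositiveStarRing S) (n : ℕ) where
  open Scalars S
  open StarRingProperties P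
  open LinAlg S n
  open FiniteSums P n

  ≈ᴹ-setoid : Setoid _ _
  ≈ᴹ-setoid = record
    { Carrier       = Mat
    ; _≈_           = _≈ᴹ_
    ; isEquivalence = record
      { refl  = λ _ _ → refl
      ; sym   = λ M≈P a b → sym (M≈P a b)
      ; trans = λ M≈P P≈Q a b → trans (M≈P a b) (P≈Q a b)
      }
    }

  module ≈ᴹ = Setoid ≈ᴹ-setoid

  *ᴹ-cong : ∀ {M M′ P P′} → M ≈ᴹ M′ → P ≈ᴹ P′ → M *ᴹ P ≈ᴹ M′ *ᴹ P′
  *ᴹ-cong M≈M′ P≈P′ a b = sumFin-cong (λ c → cong₂ _*_ (M≈M′ a c) (P≈P′ c b))

  *ᴹ-congˡ : ∀ {M P P′} → P ≈ᴹ P′ → M *ᴹ P ≈ᴹ M *ᴹ P′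
  *ᴹ-congˡ = *ᴹ-cong ≈ᴹ.refl

  *ᴹ-congʳ : ∀ {M M′ P} → M ≈ᴹ M′ → M *ᴹ P ≈ᴹ M′ *ᴹ P
  *ᴹ-congʳ M≈M′ = *ᴹ-cong M≈M′ ≈ᴹ.refl

  +ᴹ-cong : ∀ {M M′ P P′} → M ≈ᴹ M′ → P ≈ᴹ P′ → M +ᴹ P ≈ᴹ M′ +ᴹ P′
  +ᴹ-cong M≈M′ P≈P′ a b = cong₂ _+_ (M≈M′ a b) (P≈P′ a b)

  -ᴹ-cong : ∀ {M M′} → M ≈ᴹ M′ → -ᴹ M ≈ᴹ -ᴹ M′
  -ᴹ-cong M≈M′ a b = cong -_ (M≈M′ a b)

  †-cong : ∀ {M M′} → M ≈ᴹ M′ → M † ≈ᴹ M′ †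
  †-cong M≈M′ a b = cong conj (M≈M′ b a)

  tr-cong : ∀ {M M′} → M ≈ᴹ M′ → tr M ≡ tr M′
  tr-cong M≈M′ = sumFin-cong (λ a → M≈M′ a a)

  *ᴹ-assoc : ∀ M P Q → M *ᴹ P *ᴹ Q ≈ᴹ M *ᴹ (P *ᴹ Q)
  *ᴹ-assoc M P Q a b = begin
    sumFin (λ c → sumFin (λ d → M a d * P d c) * Q c b)
      ≡⟨ sumFin-cong (λ c → *-distribʳ-sumFin (Q c b) (λ d → M a d * P d c)) ⟩
    sumFin (λ c → sumFin (λ d → M a d * P d c * Q c b))
      ≡⟨ sumFin-comm (λ c d → M a d * P d c * Q c b) ⟩
    sumFin (λ d → sumFin (λ c → M a d * P d c * Q c b))
      ≡⟨ sumFin-cong (λ d → sumFin-cong (λ c → *-assoc (M a d) (P d c) (Q c b))) ⟩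
    sumFin (λ d → sumFin (λ c → M a d * (P d c * Q c b)))
      ≡⟨ sumFin-cong (λ d → sym (*-distribˡ-sumFin (M a d) (λ c → P d c * Q c b))) ⟩
    sumFin (λ d → M a d * sumFin (λ c → P d c * Q c b)) ∎
    where open ≡-Reasoning

  𝟏ᴹ-diag : ∀ a → 𝟏ᴹ a a ≡ 1#
  𝟏ᴹ-diag a with a ≟ a
  ... | yes _   = refl
  ... | no  a≢a = ⊥-elim (a≢a refl)

  𝟏ᴹ-off : ∀ {a b} → a ≢ b → 𝟏ᴹ a b ≡ 0#
  𝟏ᴹ-off {a} {b} a≢b with a ≟ b
  ... | yes a≡b = ⊥-elim (a≢b a≡b)
  ... | no  _   = refl

  *ᴹ-identityˡ : ∀ M → 𝟏ᴹ *ᴹ M ≈ᴹ M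
  *ᴹ-identityˡ M a b = begin
    sumFin (λ c → 𝟏ᴹ a c * M c b)
      ≡⟨ sumFin-single a (λ c c≢a → trans (cong (_* M c b) (𝟏ᴹ-off (c≢a ∘ sym))) (zeroˡ _)) ⟩
    𝟏ᴹ a a * M a b  ≡⟨ cong (_* M a b) (𝟏ᴹ-diag a) ⟩
    1# * M a b      ≡⟨ *-identityˡ _ ⟩
    M a b           ∎
    where open ≡-Reasoning

  *ᴹ-identityʳ : ∀ M → M *ᴹ 𝟏ᴹ ≈ᴹ M
  *ᴹ-identityʳ M a b = begin
    sumFin (λ c → M a c * 𝟏ᴹ c b)
      ≡⟨ sumFin-single b (λ c c≢b → trans (cong (M a c *_) (𝟏ᴹ-off c≢b)) (zeroʳ _)) ⟩
    M a b * 𝟏ᴹ b b  ≡⟨ cong (M a b *_) (𝟏ᴹ-diag b) ⟩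
    M a b * 1#      ≡⟨ *-identityʳ _ ⟩
    M a b           ∎
    where open ≡-Reasoning

  *ᴹ-zeroˡ : ∀ M → 𝟎ᴹ *ᴹ M ≈ᴹ 𝟎ᴹ
  *ᴹ-zeroˡ M a b = sumFin-zero {n} (λ c → zeroˡ (M c b))

  *ᴹ-zeroʳ : ∀ M → M *ᴹ 𝟎ᴹ ≈ᴹ 𝟎ᴹ
  *ᴹ-zeroʳ M a b = sumFin-zero {n} (λ c → zeroʳ (M a c))

  +ᴹ-identityˡ : ∀ M → 𝟎ᴹ +ᴹ M ≈ᴹ M
  +ᴹ-identityˡ M a b = +-identityˡ (M a b)

  +ᴹ-identityʳ : ∀ M → M +ᴹ 𝟎ᴹ ≈ᴹ M
  +ᴹ-identityʳ M a b = +-identityʳ (M a b)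

  -ᴹ-zero : -ᴹ 𝟎ᴹ ≈ᴹ 𝟎ᴹ
  -ᴹ-zero a b = -0#≈0#

  -ᴹ-involutive : ∀ M → -ᴹ (-ᴹ M) ≈ᴹ M
  -ᴹ-involutive M a b = -‿involutive _

  -ᴹ‿distribˡ-*ᴹ : ∀ M P → -ᴹ M *ᴹ P ≈ᴹ -ᴹ (M *ᴹ P)
  -ᴹ‿distribˡ-*ᴹ M P a b =
    trans (sumFin-cong (λ c → sym (-‿distribˡ-* (M a c) (P c b)))) (sumFin-neg (λ c → M a c * P c b))

  -ᴹ‿distribʳ-*ᴹ : ∀ M P → M *ᴹ -ᴹ P ≈ᴹ -ᴹ (M *ᴹ P)
  -ᴹ‿distribʳ-*ᴹ M P a b =
    trans (sumFin-cong (λ c → sym (-‿distribʳ-* (M a c) (P c b)))) (sumFin-neg (λ c → M a c * P c b))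

  -ᴹ-sandwich : ∀ g M → g *ᴹ -ᴹ M *ᴹ g ≈ᴹ -ᴹ (g *ᴹ M *ᴹ g)
  -ᴹ-sandwich g M = ≈ᴹ.trans (*ᴹ-congʳ (-ᴹ‿distribʳ-*ᴹ g M)) (-ᴹ‿distribˡ-*ᴹ (g *ᴹ M) g)

  †-*ᴹ : ∀ M P → (M *ᴹ P) † ≈ᴹ P † *ᴹ M †
  †-*ᴹ M P a b =
    trans (sumFin-conj (λ c → M b c * P c a))
          (sumFin-cong (λ c → trans (conj-* (M b c) (P c a)) (*-comm _ _)))

  𝟏ᴹ-† : 𝟏ᴹ † ≈ᴹ 𝟏ᴹ
  𝟏ᴹ-† a b with a ≟ b
  ... | yes refl = trans (cong conj (𝟏ᴹ-diag a)) conj-1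
  ... | no  a≢b  = trans (cong conj (𝟏ᴹ-off (a≢b ∘ sym))) conj-0

  tr-*ᴹ-comm : ∀ M P → tr (M *ᴹ P) ≡ tr (P *ᴹ M)
  tr-*ᴹ-comm M P =
    trans (sumFin-comm (λ a c → M a c * P c a))
          (sumFin-cong (λ c → sumFin-cong (λ a → *-comm (M a c) (P c a))))

  InG-𝟏ᴹ : InG 𝟏ᴹ
  InG-𝟏ᴹ = ≈ᴹ.trans (*ᴹ-congˡ 𝟏ᴹ-†) (*ᴹ-identityˡ 𝟏ᴹ)
         , ≈ᴹ.trans (*ᴹ-congʳ 𝟏ᴹ-†) (*ᴹ-identityˡ 𝟏ᴹ)

  conjugate-cancel : ∀ {g g′} → g *ᴹ g′ ≈ᴹ 𝟏ᴹ → g′ *ᴹ g ≈ᴹ 𝟏ᴹ →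
                     ∀ M → g *ᴹ (g′ *ᴹ M *ᴹ g′) *ᴹ g ≈ᴹ M
  conjugate-cancel {g} {g′} gg′≈𝟏 g′g≈𝟏 M = begin
    g *ᴹ (g′ *ᴹ M *ᴹ g′) *ᴹ g  ≈⟨ *ᴹ-congʳ (≈ᴹ.sym (*ᴹ-assoc g (g′ *ᴹ M) g′)) ⟩
    g *ᴹ (g′ *ᴹ M) *ᴹ g′ *ᴹ g  ≈⟨ *ᴹ-congʳ (*ᴹ-congʳ (≈ᴹ.sym (*ᴹ-assoc g g′ M))) ⟩
    g *ᴹ g′ *ᴹ M *ᴹ g′ *ᴹ g    ≈⟨ *ᴹ-congʳ (*ᴹ-congʳ (*ᴹ-congʳ gg′≈𝟏)) ⟩
    𝟏ᴹ *ᴹ M *ᴹ g′ *ᴹ g         ≈⟨ *ᴹ-congʳ (*ᴹ-congʳ (*ᴹ-identityˡ M)) ⟩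
    M *ᴹ g′ *ᴹ g               ≈⟨ *ᴹ-assoc M g′ g ⟩
    M *ᴹ (g′ *ᴹ g)             ≈⟨ *ᴹ-congˡ g′g≈𝟏 ⟩
    M *ᴹ 𝟏ᴹ                    ≈⟨ *ᴹ-identityʳ M ⟩
    M                          ∎
    where open SetoidReasoning ≈ᴹ-setoid

  ⟪_,_⟫ : Mat → Mat → K
  ⟪ M , P ⟫ = tr (M *ᴹ P †)

  ⟪⟫-cong : ∀ {M M′ P P′} → M ≈ᴹ M′ → P ≈ᴹ P′ → ⟪ M , P ⟫ ≡ ⟪ M′ , P′ ⟫
  ⟪⟫-cong M≈M′ P≈P′ = tr-cong (*ᴹ-cong M≈M′ (†-cong P≈P′))

  ⟪⟫-zeroˡ : ∀ P → ⟪ 𝟎ᴹ , P ⟫ ≡ 0#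
  ⟪⟫-zeroˡ P = sumFin-zero {n} (λ a → sumFin-zero {n} (λ c → zeroˡ (conj (P a c))))

  ⟪⟫-+ˡ : ∀ M M′ P → ⟪ M +ᴹ M′ , P ⟫ ≡ ⟪ M , P ⟫ + ⟪ M′ , P ⟫
  ⟪⟫-+ˡ M M′ P =
    trans (sumFin-cong (λ a → sumFin-cong (λ c → distribʳ (conj (P a c)) (M a c) (M′ a c))))
          (sumFin²-+ (λ a c → M a c * conj (P a c)) (λ a c → M′ a c * conj (P a c)))

  ⟪⟫-negˡ : ∀ M P → ⟪ -ᴹ M , P ⟫ ≡ - ⟪ M , P ⟫
  ⟪⟫-negˡ M P =
    trans (sumFin-cong (λ a → sumFin-cong (λ c → sym (-‿distribˡ-* (M a c) (conj (P a c))))))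
          (sumFin²-neg (λ a c → M a c * conj (P a c)))

  ⟪⟫-subʳ : ∀ M P Q → ⟪ M , P -ᴹ Q ⟫ ≡ ⟪ M , P ⟫ + - ⟪ M , Q ⟫
  ⟪⟫-subʳ M P Q = begin
    ⟪ M , P -ᴹ Q ⟫
      ≡⟨ sumFin-cong (λ a → sumFin-cong (λ c → entry a c)) ⟩
    sumFin (λ a → sumFin (λ c → M a c * conj (P a c) + - (M a c * conj (Q a c))))
      ≡⟨ sumFin²-+ (λ a c → M a c * conj (P a c)) (λ a c → - (M a c * conj (Q a c))) ⟩
    ⟪ M , P ⟫ + sumFin (λ a → sumFin (λ c → - (M a c * conj (Q a c))))
      ≡⟨ cong (⟪ M , P ⟫ +_) (sumFin²-neg (λ a c → M a c * conj (Q a c))) ⟩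
    ⟪ M , P ⟫ + - ⟪ M , Q ⟫ ∎
    where
    open ≡-Reasoning
    entry : ∀ a c → M a c * conj (P a c + - Q a c) ≡ M a c * conj (P a c) + - (M a c * conj (Q a c))
    entry a c = trans (cong (M a c *_) (trans (conj-+ _ _) (cong (conj (P a c) +_) (conj-neg (Q a c)))))
                      (x[y-z]≈xy-xz (M a c) (conj (P a c)) (conj (Q a c)))

  ⟪⟫-unitaryˡ : ∀ {g} → g † *ᴹ g ≈ᴹ 𝟏ᴹ → ∀ M P → ⟪ g *ᴹ M , g *ᴹ P ⟫ ≡ ⟪ M , P ⟫
  ⟪⟫-unitaryˡ {g} g†g≈𝟏 M P = begin
    tr (g *ᴹ M *ᴹ (g *ᴹ P) †)    ≡⟨ tr-cong (≈ᴹ.trans (*ᴹ-congˡ (†-*ᴹ g P)) (*ᴹ-assoc g M (P † *ᴹ g †))) ⟩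
    tr (g *ᴹ (M *ᴹ (P † *ᴹ g †))) ≡⟨ tr-*ᴹ-comm g _ ⟩
    tr (M *ᴹ (P † *ᴹ g †) *ᴹ g)   ≡⟨ tr-cong cancel ⟩
    tr (M *ᴹ P †)                 ∎
    where
    open ≡-Reasoning
    cancel : M *ᴹ (P † *ᴹ g †) *ᴹ g ≈ᴹ M *ᴹ P †
    cancel = ≈ᴹ.trans (*ᴹ-assoc M (P † *ᴹ g †) g)
               (*ᴹ-congˡ (≈ᴹ.trans (*ᴹ-assoc (P †) (g †) g)
                                   (≈ᴹ.trans (*ᴹ-congˡ g†g≈𝟏) (*ᴹ-identityʳ (P †)))))

  ⟪⟫-unitaryʳ : ∀ {g} → g *ᴹ g † ≈ᴹ 𝟏ᴹ → ∀ M P → ⟪ M *ᴹ g , P *ᴹ g ⟫ ≡ ⟪ M , P ⟫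
  ⟪⟫-unitaryʳ {g} gg†≈𝟏 M P = tr-cong (begin
    M *ᴹ g *ᴹ (P *ᴹ g) †      ≈⟨ *ᴹ-congˡ (†-*ᴹ P g) ⟩
    M *ᴹ g *ᴹ (g † *ᴹ P †)    ≈⟨ *ᴹ-assoc M g _ ⟩
    M *ᴹ (g *ᴹ (g † *ᴹ P †))  ≈⟨ *ᴹ-congˡ (≈ᴹ.sym (*ᴹ-assoc g (g †) (P †))) ⟩
    M *ᴹ (g *ᴹ g † *ᴹ P †)    ≈⟨ *ᴹ-congˡ (*ᴹ-congʳ gg†≈𝟏) ⟩
    M *ᴹ (𝟏ᴹ *ᴹ P †)          ≈⟨ *ᴹ-congˡ (*ᴹ-identityˡ (P †)) ⟩
    M *ᴹ P †                  ∎)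
    where open SetoidReasoning ≈ᴹ-setoid

  ⟪⟫-twist : ∀ {g g′} → InG g → g *ᴹ g′ ≈ᴹ 𝟏ᴹ → g′ *ᴹ g ≈ᴹ 𝟏ᴹ →
             ∀ M P → ⟪ g′ *ᴹ M *ᴹ g′ , P ⟫ ≡ ⟪ M , g *ᴹ P *ᴹ g ⟫
  ⟪⟫-twist {g} {g′} (gg†≈𝟏 , g†g≈𝟏) gg′≈𝟏 g′g≈𝟏 M P = begin
    ⟪ g′ *ᴹ M *ᴹ g′ , P ⟫                  ≡⟨ sym (⟪⟫-unitaryʳ gg†≈𝟏 _ P) ⟩
    ⟪ N *ᴹ g , P *ᴹ g ⟫                    ≡⟨ sym (⟪⟫-unitaryˡ g†g≈𝟏 _ _) ⟩
    ⟪ g *ᴹ (N *ᴹ g) , g *ᴹ (P *ᴹ g) ⟫      ≡⟨ ⟪⟫-cong (≈ᴹ.trans (≈ᴹ.sym (*ᴹ-assoc g N g))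
                                                               (conjugate-cancel gg′≈𝟏 g′g≈𝟏 M))
                                                      (≈ᴹ.sym (*ᴹ-assoc g P g)) ⟩
    ⟪ M , g *ᴹ P *ᴹ g ⟫                    ∎
    where
    open ≡-Reasoning
    N : Mat
    N = g′ *ᴹ M *ᴹ g′

  ⟪⟫-self-zero : ∀ M → ⟪ M , M ⟫ ≡ 0# → M ≈ᴹ 𝟎ᴹ
  ⟪⟫-self-zero M ⟪M,M⟫≡0 a c = norm-zero (M a c) (sumFin-NonNeg-zero (row a) (norms a) (row-zero a) c)
    where
    row : Fin n → Fin n → K
    row a c = M a c * conj (M a c)
    norms : ∀ a c → NonNeg (row a c)
    norms a c = NonNeg-norm (M a c)
    row-zero : ∀ a → sumFin (row a) ≡ 0#
    row-zero = sumFin-NonNeg-zero (λ a → sumFin (row a)) (λ a → sumFin-NonNeg (row a) (norms a)) ⟪M,M⟫≡0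

module TwistedForms {S : Scalars} (P : IsPositiveStarRing S) (n : ℕ) {N : ℕ} (Γ : Graph N) where
  open Scalars S
  open StarRingProperties P
  open LinAlg S n
  open FiniteSums P n
  open Matrices P n
  open Graph Γ
  open GraphNotions Γ
  open Forms S n Γ

  Edge-sym : ∀ {i j} → Edge i j → Edge j i
  Edge-sym {i} {j} e = trans (adj-sym j i) e

  ¬Edge⇒≢ : ∀ {i j c d} → Edge i j → adj c d ≡ false → ¬ (c ≡ i × d ≡ j)
  ¬Edge⇒≢ e ¬e (refl , refl) with () ← trans (sym e) ¬e

  Edge⇒≢ : ∀ {i j} → Edge i j → i ≢ j
  Edge⇒≢ {i} e refl with () ← trans (sym e) (adj-irrefl i)

  -- ⟨ φ , ψ ⟩₁ ≡ inv (1# + 1#) * ⟪ φ , ψ ⟫₁ holds definitionally.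
  ⟪_,_⟫₁ : OneForm → OneForm → K
  ⟪ φ , ψ ⟫₁ = sumFin (λ i → sumFin (λ j → ⟪ φ i j , ψ i j ⟫))

  ⟪⟫₁-+ˡ : ∀ φ φ′ ψ → ⟪ (λ i j → φ i j +ᴹ φ′ i j) , ψ ⟫₁ ≡ ⟪ φ , ψ ⟫₁ + ⟪ φ′ , ψ ⟫₁
  ⟪⟫₁-+ˡ φ φ′ ψ = trans (sumFin-cong (λ i → sumFin-cong (λ j → ⟪⟫-+ˡ (φ i j) (φ′ i j) (ψ i j))))
                        (sumFin²-+ (λ i j → ⟪ φ i j , ψ i j ⟫) (λ i j → ⟪ φ′ i j , ψ i j ⟫))

  at : Fin N → Fin N → Mat → OneForm
  at i j M c d with c ≟ i ×-dec d ≟ j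
  ... | yes _ = M
  ... | no  _ = 𝟎ᴹ

  at-diag : ∀ i j M → at i j M i j ≡ M
  at-diag i j M with i ≟ i ×-dec j ≟ j
  ... | yes _ = refl
  ... | no ¬ij = ⊥-elim (¬ij (refl , refl))

  at-off : ∀ {i j c d} M → ¬ (c ≡ i × d ≡ j) → at i j M c d ≡ 𝟎ᴹ
  at-off {i} {j} {c} {d} M ¬cd with c ≟ i ×-dec d ≟ j
  ... | yes cd = ⊥-elim (¬cd cd)
  ... | no  _  = refl

  ⟪at⟫₁ : ∀ i j M ψ → ⟪ at i j M , ψ ⟫₁ ≡ ⟪ M , ψ i j ⟫
  ⟪at⟫₁ i j M ψ = begin
    ⟪ at i j M , ψ ⟫₁
      ≡⟨ sumFin-single i (λ c c≢i → sumFin-zero {N} (λ d → off {c} {d} (λ (c≡i , _) → c≢i c≡i))) ⟩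
    sumFin (λ d → ⟪ at i j M i d , ψ i d ⟫)
      ≡⟨ sumFin-single j (λ d d≢j → off (λ (_ , d≡j) → d≢j d≡j)) ⟩
    ⟪ at i j M i j , ψ i j ⟫
      ≡⟨ cong (λ M′ → ⟪ M′ , ψ i j ⟫) (at-diag i j M) ⟩
    ⟪ M , ψ i j ⟫ ∎
    where
    open ≡-Reasoning
    off : ∀ {c d} → ¬ (c ≡ i × d ≡ j) → ⟪ at i j M c d , ψ c d ⟫ ≡ 0#
    off {c} {d} ¬cd = trans (cong (λ M′ → ⟪ M′ , ψ c d ⟫) (at-off M ¬cd)) (⟪⟫-zeroˡ (ψ c d))

  module _ (U : Fin N → Fin N → Mat)
           (U-unitary : ∀ i j → Edge i j → InG (U i j))
           (U-inverse : ∀ i j → Edge i j → U i j *ᴹ U j i ≈ᴹ 𝟏ᴹ) where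

    IsTwistedAntisymmetric : OneForm → Set
    IsTwistedAntisymmetric δ =
      Is1Form δ × (∀ i j → Edge i j → δ j i ≈ᴹ -ᴹ (U j i *ᴹ δ i j *ᴹ U j i))

    IsTwistedSymmetric : OneForm → Set
    IsTwistedSymmetric X = ∀ i j → Edge i j → X i j ≈ᴹ U i j *ᴹ X j i *ᴹ U i j

    ⟪⟫-twist-edge : ∀ {i j} → Edge i j → ∀ M M′ →
                    ⟪ U j i *ᴹ M *ᴹ U j i , M′ ⟫ ≡ ⟪ M , U i j *ᴹ M′ *ᴹ U i j ⟫
    ⟪⟫-twist-edge {i} {j} e = ⟪⟫-twist (U-unitary i j e) (U-inverse i j e) (U-inverse j i (Edge-sym e))

    twistedSymmetric⇒orthogonal : ∀ {X} → IsTwistedSymmetric X →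
                                  ∀ {δ} → IsTwistedAntisymmetric δ → ⟨ δ , X ⟩₁ ≡ 0#
    twistedSymmetric⇒orthogonal {X} X-sym {δ} (δ-form , δ-anti) =
      trans (cong (inv (1# + 1#) *_) (x≡-x⇒x≡0 ⟪ δ , X ⟫₁ ⟪δ,X⟫₁≡-⟪δ,X⟫₁)) (zeroʳ _)
      where
      open ≡-Reasoning
      t : Fin N → Fin N → K
      t i j = ⟪ δ i j , X i j ⟫

      t-anti : ∀ i j → t j i ≡ - t i j
      t-anti i j with adj i j in e
      ... | true = begin
        ⟪ δ j i , X j i ⟫                              ≡⟨ ⟪⟫-cong (δ-anti i j e) ≈ᴹ.refl ⟩
        ⟪ -ᴹ (U j i *ᴹ δ i j *ᴹ U j i) , X j i ⟫        ≡⟨ ⟪⟫-negˡ _ (X j i) ⟩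
        - ⟪ U j i *ᴹ δ i j *ᴹ U j i , X j i ⟫           ≡⟨ cong -_ (⟪⟫-twist-edge e (δ i j) (X j i)) ⟩
        - ⟪ δ i j , U i j *ᴹ X j i *ᴹ U i j ⟫           ≡⟨ cong -_ (⟪⟫-cong ≈ᴹ.refl (≈ᴹ.sym (X-sym i j e))) ⟩
        - ⟪ δ i j , X i j ⟫                            ∎
      ... | false = begin
        ⟪ δ j i , X j i ⟫    ≡⟨ zero-off-edge (trans (adj-sym j i) e) ⟩
        0#                   ≡⟨ sym -0#≈0# ⟩
        - 0#                 ≡⟨ cong -_ (sym (zero-off-edge e)) ⟩
        - ⟪ δ i j , X i j ⟫  ∎
        where
        zero-off-edge : ∀ {c d} → adj c d ≡ false → t c d ≡ 0#
        zero-off-edge {c} {d} ¬e = trans (⟪⟫-cong (δ-form c d ¬e) ≈ᴹ.refl) (⟪⟫-zeroˡ (X c d))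

      ⟪δ,X⟫₁≡-⟪δ,X⟫₁ : ⟪ δ , X ⟫₁ ≡ - ⟪ δ , X ⟫₁
      ⟪δ,X⟫₁≡-⟪δ,X⟫₁ = begin
        sumFin (λ i → sumFin (λ j → t i j))    ≡⟨ sumFin-comm t ⟩
        sumFin (λ j → sumFin (λ i → t i j))    ≡⟨ sumFin-cong (λ j → sumFin-cong (λ i → t-anti j i)) ⟩
        sumFin (λ j → sumFin (λ i → - t j i))  ≡⟨ sumFin²-neg t ⟩
        - sumFin (λ j → sumFin (λ i → t j i))  ∎

    edgeVariation : Fin N → Fin N → Mat → OneForm
    edgeVariation i j Y c d = at i j Y c d +ᴹ at j i (-ᴹ (U j i *ᴹ Y *ᴹ U j i)) c d

    module _ {i j : Fin N} (e : Edge i j) (Y : Mat) where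
      private
        δ : OneForm
        δ = edgeVariation i j Y
        Z : Mat
        Z = -ᴹ (U j i *ᴹ Y *ᴹ U j i)
        i≢j : i ≢ j
        i≢j = Edge⇒≢ e
        U-inverse-ji : U j i *ᴹ U i j ≈ᴹ 𝟏ᴹ
        U-inverse-ji = U-inverse j i (Edge-sym e)

      edgeVariation-ij : δ i j ≈ᴹ Y
      edgeVariation-ij = ≈ᴹ.trans (+ᴹ-cong (≈ᴹ.reflexive (at-diag i j Y))
                                           (≈ᴹ.reflexive (at-off Z (λ (i≡j , _) → i≢j i≡j))))
                                  (+ᴹ-identityʳ Y)

      edgeVariation-ji : δ j i ≈ᴹ Z
      edgeVariation-ji = ≈ᴹ.trans (+ᴹ-cong (≈ᴹ.reflexive (at-off Y (λ (j≡i , _) → i≢j (sym j≡i))))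
                                           (≈ᴹ.reflexive (at-diag j i Z)))
                                  (+ᴹ-identityˡ Z)

      edgeVariation-off : ∀ {c d} → ¬ (c ≡ i × d ≡ j) → ¬ (c ≡ j × d ≡ i) → δ c d ≈ᴹ 𝟎ᴹ
      edgeVariation-off ¬ij ¬ji =
        ≈ᴹ.trans (+ᴹ-cong (≈ᴹ.reflexive (at-off Y ¬ij)) (≈ᴹ.reflexive (at-off Z ¬ji))) (+ᴹ-identityʳ 𝟎ᴹ)

      edgeVariation-twistedAntisymmetric : IsTwistedAntisymmetric δ
      edgeVariation-twistedAntisymmetric =
          (λ c d ¬e → edgeVariation-off (¬Edge⇒≢ e ¬e) (¬Edge⇒≢ (Edge-sym e) ¬e))
        , (λ c d _ → by-cases (c ≟ i ×-dec d ≟ j) (c ≟ j ×-dec d ≟ i))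
        where
        open SetoidReasoning ≈ᴹ-setoid
        by-cases : ∀ {c d} → Dec (c ≡ i × d ≡ j) → Dec (c ≡ j × d ≡ i) →
                   δ d c ≈ᴹ -ᴹ (U d c *ᴹ δ c d *ᴹ U d c)
        by-cases (yes (refl , refl)) _ =
          ≈ᴹ.trans edgeVariation-ji (-ᴹ-cong (*ᴹ-congʳ (*ᴹ-congˡ (≈ᴹ.sym edgeVariation-ij))))
        by-cases (no _) (yes (refl , refl)) = begin
          δ i j                                   ≈⟨ edgeVariation-ij ⟩
          Y                                       ≈⟨ ≈ᴹ.sym (conjugate-cancel (U-inverse i j e) U-inverse-ji Y) ⟩
          U i j *ᴹ (U j i *ᴹ Y *ᴹ U j i) *ᴹ U i j  ≈⟨ ≈ᴹ.sym (-ᴹ-involutive _) ⟩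
          -ᴹ (-ᴹ (U i j *ᴹ (U j i *ᴹ Y *ᴹ U j i) *ᴹ U i j))
                                                  ≈⟨ -ᴹ-cong (≈ᴹ.sym (-ᴹ-sandwich (U i j) _)) ⟩
          -ᴹ (U i j *ᴹ Z *ᴹ U i j)                ≈⟨ -ᴹ-cong (*ᴹ-congʳ (*ᴹ-congˡ (≈ᴹ.sym edgeVariation-ji))) ⟩
          -ᴹ (U i j *ᴹ δ j i *ᴹ U i j)            ∎
        by-cases {c} {d} (no ¬ij) (no ¬ji) = begin
          δ d c                         ≈⟨ edgeVariation-off (¬ji ∘ swap) (¬ij ∘ swap) ⟩
          𝟎ᴹ                            ≈⟨ ≈ᴹ.sym -ᴹ-zero ⟩
          -ᴹ 𝟎ᴹ                         ≈⟨ -ᴹ-cong (≈ᴹ.sym (≈ᴹ.trans (*ᴹ-congʳ (*ᴹ-zeroʳ _)) (*ᴹ-zeroˡ _))) ⟩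
          -ᴹ (U d c *ᴹ 𝟎ᴹ *ᴹ U d c)     ≈⟨ -ᴹ-cong (*ᴹ-congʳ (*ᴹ-congˡ (≈ᴹ.sym (edgeVariation-off ¬ij ¬ji)))) ⟩
          -ᴹ (U d c *ᴹ δ c d *ᴹ U d c)  ∎

      ⟪edgeVariation⟫₁ : ∀ X → ⟪ δ , X ⟫₁ ≡ ⟪ Y , X i j ⟫ + ⟪ Z , X j i ⟫
      ⟪edgeVariation⟫₁ X =
        trans (⟪⟫₁-+ˡ (at i j Y) (at j i Z) X) (cong₂ _+_ (⟪at⟫₁ i j Y X) (⟪at⟫₁ j i Z X))

    orthogonal⇒twistedSymmetric : ∀ {X} → (∀ δ → IsTwistedAntisymmetric δ → ⟨ δ , X ⟩₁ ≡ 0#) →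
                                  IsTwistedSymmetric X
    orthogonal⇒twistedSymmetric {X} X⊥ i j e a b = x∙y⁻¹≈ε⇒x≈y _ _ (⟪⟫-self-zero Y ⟪Y,Y⟫≡0 a b)
      where
      open ≡-Reasoning
      Y : Mat
      Y = X i j -ᴹ U i j *ᴹ X j i *ᴹ U i j

      ⟪Y,Y⟫≡0 : ⟪ Y , Y ⟫ ≡ 0#
      ⟪Y,Y⟫≡0 = begin
        ⟪ Y , Y ⟫
          ≡⟨ ⟪⟫-subʳ Y (X i j) (U i j *ᴹ X j i *ᴹ U i j) ⟩
        ⟪ Y , X i j ⟫ + - ⟪ Y , U i j *ᴹ X j i *ᴹ U i j ⟫
          ≡⟨ cong (λ z → ⟪ Y , X i j ⟫ + - z) (sym (⟪⟫-twist-edge e Y (X j i))) ⟩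
        ⟪ Y , X i j ⟫ + - ⟪ U j i *ᴹ Y *ᴹ U j i , X j i ⟫
          ≡⟨ cong (⟪ Y , X i j ⟫ +_) (sym (⟪⟫-negˡ _ (X j i))) ⟩
        ⟪ Y , X i j ⟫ + ⟪ -ᴹ (U j i *ᴹ Y *ᴹ U j i) , X j i ⟫
          ≡⟨ sym (⟪edgeVariation⟫₁ e Y X) ⟩
        ⟪ edgeVariation i j Y , X ⟫₁
          ≡⟨ half*x≡0⇒x≡0 _ (X⊥ _ (edgeVariation-twistedAntisymmetric e Y)) ⟩
        0# ∎

module YangMills {S : Scalars} (P : IsPositiveStarRing S) (n : ℕ) {N : ℕ} (Γ : Graph N)
                 (R : LinAlg.Representation S n) (C : Forms.Connection S n Γ) where
  open LinAlg S n
  open Matrices P n using (module ≈ᴹ; ≈ᴹ-setoid; InG-𝟏ᴹ)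
  open GraphNotions Γ
  open Forms S n Γ
  open TwistedForms P n Γ
  open Representation R
  open Connection C

  ρA-inverse : ∀ i j → Edge i j → ρ (A i j) *ᴹ ρ (A j i) ≈ᴹ 𝟏ᴹ
  ρA-inverse i j e = begin
    ρ (A i j) *ᴹ ρ (A j i)  ≈⟨ ρ-hom (A-G i j e) (A-G j i (Edge-sym e)) ⟨
    ρ (A i j *ᴹ A j i)      ≈⟨ ρ-wd InG-𝟏ᴹ (≈ᴹ.sym (A-inv i j e)) ⟨
    ρ 𝟏ᴹ                    ≈⟨ ρ-id ⟩
    𝟏ᴹ                      ∎
    where open SetoidReasoning ≈ᴹ-setoid

  curvature-is2Form : Is2Form (curvature R C)
  curvature-is2Form i j k ¬tri a b rewrite ¬tri = refl

  -- For U i j = ρ (A i j), IsVariation is IsTwistedAntisymmetric U and YangMillsCondition D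
  -- is IsTwistedSymmetric U (D F), definitionally.
  firstVariationVanishes⇔yangMills : ∀ D → IsAdjointOfd-A R C D →
    (FirstVariationVanishes R C → YangMillsCondition R C D) ×
    (YangMillsCondition R C D → FirstVariationVanishes R C)
  firstVariationVanishes⇔yangMills D (_ , adjoint) =
      (λ fv → orthogonal⇒twistedSymmetric U U-unitary ρA-inverse
                (λ δ δ-var → trans (sym (adjoint δ F (proj₁ δ-var) curvature-is2Form)) (fv δ δ-var)))
    , (λ ym δ δ-var → trans (adjoint δ F (proj₁ δ-var) curvature-is2Form)
                            (twistedSymmetric⇒orthogonal U U-unitary ρA-inverse ym δ-var))
    where
    F : TwoForm
    F = curvature R C
    U : Fin N → Fin N → Mat
    U i j = ρ (A i j)
    U-unitary : ∀ i j → Edge i j → InG (U i j)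
    U-unitary i j e = ρ-unitary (A-G i j e)

module OrderedFieldProperties (R : RealField) where
  open RealField R
  open IsStrictTotalOrder isStrictTotalOrder using (compare; irrefl) renaming (_≟_ to _≟ℝ_; trans to <-trans)

  commutativeRing : CommutativeRing _ _
  commutativeRing = record { isCommutativeRing = isCommutativeRing }

  open CommutativeRing commutativeRing public
    using ( ring; +-commutativeSemigroup
          ; +-assoc; +-comm; +-identityˡ; +-identityʳ; -‿inverseˡ; -‿inverseʳ
          ; *-assoc; *-comm; *-identityˡ; distribˡ; distribʳ; zeroˡ; zeroʳ )
  open RingProperties ring public
    using (-‿distribˡ-*; -‿distribʳ-*; -0#≈0#; -‿involutive; -‿+-comm; x[y-z]≈xy-xz; [y-z]x≈yx-zx)
  open CommutativeSemigroupProperties +-commutativeSemigroup public using (interchange)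

  -x*-y≡x*y : ∀ x y → (- x) * (- y) ≡ x * y
  -x*-y≡x*y x y =
    trans (sym (-‿distribˡ-* x (- y))) (trans (cong -_ (sym (-‿distribʳ-* x y))) (-‿involutive _))

  NonNeg : ℝ → Set
  NonNeg x = x ≡ 0ℝ ⊎ 0ℝ < x

  <-irrefl : ∀ {x} → ¬ (x < x)
  <-irrefl = irrefl refl

  x<0⇒0<-x : ∀ {x} → x < 0ℝ → 0ℝ < - x
  x<0⇒0<-x {x} x<0 = subst₂ _<_ (-‿inverseʳ x) (+-identityˡ (- x)) (+-mono-< (- x) x<0)

  square-pos : ∀ {x} → x ≢ 0ℝ → 0ℝ < x * x
  square-pos {x} x≢0 with compare 0ℝ x
  ... | tri< 0<x _ _ = *-pos 0<x 0<x
  ... | tri≈ _ 0≡x _ = ⊥-elim (x≢0 (sym 0≡x))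
  ... | tri> _ _ x<0 = subst (0ℝ <_) (-x*-y≡x*y x x) (*-pos (x<0⇒0<-x x<0) (x<0⇒0<-x x<0))

  0<1 : 0ℝ < 1ℝ
  0<1 = subst (0ℝ <_) (*-identityˡ 1ℝ) (square-pos (0≢1 ∘ sym))

  pos-+ : ∀ {x y} → 0ℝ < x → 0ℝ < y → 0ℝ < x + y
  pos-+ {x} {y} 0<x 0<y = <-trans (subst (0ℝ <_) (sym (+-identityˡ y)) 0<y) (+-mono-< y 0<x)

  0<x⇒x≢0 : ∀ {x} → 0ℝ < x → x ≢ 0ℝ
  0<x⇒x≢0 0<x x≡0 = <-irrefl (subst (0ℝ <_) x≡0 0<x)

  NonNeg-square : ∀ x → NonNeg (x * x)
  NonNeg-square x with x ≟ℝ 0ℝ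
  ... | yes x≡0 = inj₁ (trans (cong (_* x) x≡0) (zeroˡ x))
  ... | no  x≢0 = inj₂ (square-pos x≢0)

  NonNeg-+ : ∀ {x y} → NonNeg x → NonNeg y → NonNeg (x + y)
  NonNeg-+ (inj₁ refl) y≥0          = subst NonNeg (sym (+-identityˡ _)) y≥0
  NonNeg-+ (inj₂ 0<x)  (inj₁ refl)  = inj₂ (subst (0ℝ <_) (sym (+-identityʳ _)) 0<x)
  NonNeg-+ (inj₂ 0<x)  (inj₂ 0<y)   = inj₂ (pos-+ 0<x 0<y)

  NonNeg-+-zeroˡ : ∀ {x y} → NonNeg x → NonNeg y → x + y ≡ 0ℝ → x ≡ 0ℝ
  NonNeg-+-zeroˡ (inj₁ x≡0)     _           _     = x≡0
  NonNeg-+-zeroˡ {x} (inj₂ _)   (inj₁ refl) x+0≡0 = trans (sym (+-identityʳ x)) x+0≡0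
  NonNeg-+-zeroˡ (inj₂ 0<x)     (inj₂ 0<y)  x+y≡0 = ⊥-elim (0<x⇒x≢0 (pos-+ 0<x 0<y) x+y≡0)

  square-zero : ∀ x → x * x ≡ 0ℝ → x ≡ 0ℝ
  square-zero x x²≡0 with x ≟ℝ 0ℝ
  ... | yes x≡0 = x≡0
  ... | no  x≢0 = ⊥-elim (0<x⇒x≢0 (square-pos x≢0) x²≡0)

  1+1≢0 : 1ℝ + 1ℝ ≢ 0ℝ
  1+1≢0 = 0<x⇒x≢0 (pos-+ 0<1 0<1)

realPositiveStarRing : (R : RealField) → IsPositiveStarRing (realScalars R)
realPositiveStarRing R = record
  { isCommutativeRing = isCommutativeRing
  ; conj-+            = λ _ _ → refl
  ; conj-*            = λ _ _ → refl
  ; conj-1            = refl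
  ; inv-2             = trans (*-comm _ _) (inv-inverse _ 1+1≢0)
  ; NonNeg            = NonNeg
  ; NonNeg-+          = NonNeg-+
  ; NonNeg-norm       = NonNeg-square
  ; NonNeg-+-zeroˡ    = NonNeg-+-zeroˡ
  ; norm-zero         = square-zero
  }
  where
  open RealField R
  open OrderedFieldProperties R

module ComplexNumbers (R : RealField) where
  open RealField R
  open OrderedFieldProperties R
  open Scalars (complexScalars R) using ()
    renaming (K to ℂ; _+_ to _+ℂ_; _*_ to _*ℂ_; -_ to -ℂ_; 0# to 0ℂ; 1# to 1ℂ; conj to conjℂ; inv to invℂ)
  open ≡-Reasoning

  [x-y]-[z+w]≡[x-z]-[w+y] : ∀ x y z w → (x + - y) + - (z + w) ≡ (x + - z) + - (w + y)
  [x-y]-[z+w]≡[x-z]-[w+y] x y z w = begin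
    (x + - y) + - (z + w)    ≡⟨ cong ((x + - y) +_) (sym (-‿+-comm z w)) ⟩
    (x + - y) + (- z + - w)  ≡⟨ interchange x (- y) (- z) (- w) ⟩
    (x + - z) + (- y + - w)  ≡⟨ cong ((x + - z) +_) (trans (+-comm (- y) (- w)) (-‿+-comm w y)) ⟩
    (x + - z) + - (w + y)    ∎

  [x-y]+[z+w]≡[x+z]+[w-y] : ∀ x y z w → (x + - y) + (z + w) ≡ (x + z) + (w + - y)
  [x-y]+[z+w]≡[x+z]+[w-y] x y z w = trans (interchange x (- y) z w) (cong ((x + z) +_) (+-comm (- y) w))

  +ℂ-assoc : ∀ x y z → (x +ℂ y) +ℂ z ≡ x +ℂ (y +ℂ z)
  +ℂ-assoc (a , b) (c , d) (e , f) = cong₂ _,_ (+-assoc a c e) (+-assoc b d f)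

  +ℂ-comm : ∀ x y → x +ℂ y ≡ y +ℂ x
  +ℂ-comm (a , b) (c , d) = cong₂ _,_ (+-comm a c) (+-comm b d)

  +ℂ-identityˡ : ∀ x → 0ℂ +ℂ x ≡ x
  +ℂ-identityˡ (a , b) = cong₂ _,_ (+-identityˡ a) (+-identityˡ b)

  +ℂ-identityʳ : ∀ x → x +ℂ 0ℂ ≡ x
  +ℂ-identityʳ (a , b) = cong₂ _,_ (+-identityʳ a) (+-identityʳ b)

  -ℂ‿inverseˡ : ∀ x → (-ℂ x) +ℂ x ≡ 0ℂ
  -ℂ‿inverseˡ (a , b) = cong₂ _,_ (-‿inverseˡ a) (-‿inverseˡ b)

  -ℂ‿inverseʳ : ∀ x → x +ℂ (-ℂ x) ≡ 0ℂ
  -ℂ‿inverseʳ (a , b) = cong₂ _,_ (-‿inverseʳ a) (-‿inverseʳ b)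

  *ℂ-comm : ∀ x y → x *ℂ y ≡ y *ℂ x
  *ℂ-comm (a , b) (c , d) = cong₂ _,_
    (cong₂ _+_ (*-comm a c) (cong -_ (*-comm b d)))
    (trans (+-comm (a * d) (b * c)) (cong₂ _+_ (*-comm b c) (*-comm a d)))

  *ℂ-identityˡ : ∀ x → 1ℂ *ℂ x ≡ x
  *ℂ-identityˡ (a , b) = cong₂ _,_
    (trans (cong₂ _+_ (*-identityˡ a) (trans (cong -_ (zeroˡ b)) -0#≈0#)) (+-identityʳ a))
    (trans (cong₂ _+_ (*-identityˡ b) (zeroˡ a)) (+-identityʳ b))

  *ℂ-identityʳ : ∀ x → x *ℂ 1ℂ ≡ x
  *ℂ-identityʳ x = trans (*ℂ-comm x 1ℂ) (*ℂ-identityˡ x)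

  *ℂ-distribˡ : ∀ x y z → x *ℂ (y +ℂ z) ≡ (x *ℂ y) +ℂ (x *ℂ z)
  *ℂ-distribˡ (a , b) (c , d) (e , f) = cong₂ _,_
    (begin
      a * (c + e) + - (b * (d + f))              ≡⟨ cong₂ _+_ (distribˡ a c e) (cong -_ (distribˡ b d f)) ⟩
      (a * c + a * e) + - (b * d + b * f)        ≡⟨ cong ((a * c + a * e) +_) (sym (-‿+-comm _ _)) ⟩
      (a * c + a * e) + (- (b * d) + - (b * f))  ≡⟨ interchange _ _ _ _ ⟩
      (a * c + - (b * d)) + (a * e + - (b * f))  ∎)
    (trans (cong₂ _+_ (distribˡ a d f) (distribˡ b c e)) (interchange _ _ _ _))

  *ℂ-distribʳ : ∀ x y z → (y +ℂ z) *ℂ x ≡ (y *ℂ x) +ℂ (z *ℂ x)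
  *ℂ-distribʳ x y z =
    trans (*ℂ-comm (y +ℂ z) x) (trans (*ℂ-distribˡ x y z) (cong₂ _+ℂ_ (*ℂ-comm x y) (*ℂ-comm x z)))

  *ℂ-assoc : ∀ x y z → (x *ℂ y) *ℂ z ≡ x *ℂ (y *ℂ z)
  *ℂ-assoc (a , b) (c , d) (e , f) = cong₂ _,_
    (begin
      (a * c + - (b * d)) * e + - ((a * d + b * c) * f)
        ≡⟨ cong₂ _+_ ([y-z]x≈yx-zx e _ _) (cong -_ (distribʳ f _ _)) ⟩
      (a * c * e + - (b * d * e)) + - (a * d * f + b * c * f)
        ≡⟨ cong₂ _+_ (cong₂ _+_ (*-assoc a c e) (cong -_ (*-assoc b d e)))
                     (cong -_ (cong₂ _+_ (*-assoc a d f) (*-assoc b c f))) ⟩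
      (a * (c * e) + - (b * (d * e))) + - (a * (d * f) + b * (c * f))
        ≡⟨ [x-y]-[z+w]≡[x-z]-[w+y] _ _ _ _ ⟩
      (a * (c * e) + - (a * (d * f))) + - (b * (c * f) + b * (d * e))
        ≡⟨ cong₂ _+_ (sym (x[y-z]≈xy-xz a _ _)) (cong -_ (sym (distribˡ b _ _))) ⟩
      a * (c * e + - (d * f)) + - (b * (c * f + d * e)) ∎)
    (begin
      (a * c + - (b * d)) * f + (a * d + b * c) * e
        ≡⟨ cong₂ _+_ ([y-z]x≈yx-zx f _ _) (distribʳ e _ _) ⟩
      (a * c * f + - (b * d * f)) + (a * d * e + b * c * e)
        ≡⟨ cong₂ _+_ (cong₂ _+_ (*-assoc a c f) (cong -_ (*-assoc b d f)))
                     (cong₂ _+_ (*-assoc a d e) (*-assoc b c e)) ⟩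
      (a * (c * f) + - (b * (d * f))) + (a * (d * e) + b * (c * e))
        ≡⟨ [x-y]+[z+w]≡[x+z]+[w-y] _ _ _ _ ⟩
      (a * (c * f) + a * (d * e)) + (b * (c * e) + - (b * (d * f)))
        ≡⟨ cong₂ _+_ (sym (distribˡ a _ _)) (sym (x[y-z]≈xy-xz b _ _)) ⟩
      a * (c * f + d * e) + b * (c * e + - (d * f)) ∎)

  isCommutativeRingℂ : IsCommutativeRing _≡_ _+ℂ_ _*ℂ_ -ℂ_ 0ℂ 1ℂ
  isCommutativeRingℂ = record
    { isRing = record
      { +-isAbelianGroup = record
        { isGroup = record
          { isMonoid = record
            { isSemigroup = record
              { isMagma = record { isEquivalence = isEquivalence ; ∙-cong = cong₂ _+ℂ_ }
              ; assoc   = +ℂ-assoc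
              }
            ; identity = +ℂ-identityˡ , +ℂ-identityʳ
            }
          ; inverse = -ℂ‿inverseˡ , -ℂ‿inverseʳ
          ; ⁻¹-cong = cong -ℂ_
          }
        ; comm = +ℂ-comm
        }
      ; *-cong     = cong₂ _*ℂ_
      ; *-assoc    = *ℂ-assoc
      ; *-identity = *ℂ-identityˡ , *ℂ-identityʳ
      ; distrib    = *ℂ-distribˡ , *ℂ-distribʳ
      }
    ; *-comm = *ℂ-comm
    }

  NonNegℂ : ℂ → Set
  NonNegℂ z = NonNeg (proj₁ z) × proj₂ z ≡ 0ℝ

  normℂ : ∀ a b → (a , b) *ℂ conjℂ (a , b) ≡ (a * a + b * b , 0ℝ)
  normℂ a b = cong₂ _,_
    (cong (a * a +_) (trans (cong -_ (sym (-‿distribʳ-* b b))) (-‿involutive _)))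
    (trans (cong₂ _+_ (sym (-‿distribʳ-* a b)) (*-comm b a)) (-‿inverseˡ _))

  normℂ-zero : ∀ z → z *ℂ conjℂ z ≡ 0ℂ → z ≡ 0ℂ
  normℂ-zero (a , b) zz̄≡0 = cong₂ _,_
    (square-zero a (NonNeg-+-zeroˡ (NonNeg-square a) (NonNeg-square b) a²+b²≡0))
    (square-zero b (NonNeg-+-zeroˡ (NonNeg-square b) (NonNeg-square a) (trans (+-comm _ _) a²+b²≡0)))
    where
    a²+b²≡0 : a * a + b * b ≡ 0ℝ
    a²+b²≡0 = cong proj₁ (trans (sym (normℂ a b)) zz̄≡0)

  invℂ-inverseˡ-real : ∀ t → t ≢ 0ℝ → invℂ (t , 0ℝ) *ℂ (t , 0ℝ) ≡ 1ℂ
  invℂ-inverseˡ-real t t≢0 = cong₂ _,_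
    (begin
      t * w * t + - (- (0ℝ * w) * 0ℝ)  ≡⟨ cong (t * w * t +_) (trans (cong -_ (zeroʳ _)) -0#≈0#) ⟩
      t * w * t + 0ℝ                   ≡⟨ +-identityʳ _ ⟩
      t * w * t                        ≡⟨ *-assoc t w t ⟩
      t * (w * t)                      ≡⟨ cong (t *_) (*-comm w t) ⟩
      t * (t * w)                      ≡⟨ sym (*-assoc t t w) ⟩
      t * t * w                        ≡⟨ cong (λ z → t * t * inv z) t²+0²≡t² ⟩
      t * t * inv (t * t)              ≡⟨ inv-inverse _ (0<x⇒x≢0 (square-pos t≢0)) ⟩
      1ℝ                               ∎)
    (trans (cong₂ _+_ (zeroʳ _) (trans (cong (_* t) (trans (cong -_ (zeroˡ w)) -0#≈0#)) (zeroˡ t)))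
           (+-identityˡ 0ℝ))
    where
    w : ℝ
    w = inv (t * t + 0ℝ * 0ℝ)
    t²+0²≡t² : t * t + 0ℝ * 0ℝ ≡ t * t
    t²+0²≡t² = trans (cong (t * t +_) (zeroˡ 0ℝ)) (+-identityʳ _)

  conjℂ-+ : ∀ x y → conjℂ (x +ℂ y) ≡ conjℂ x +ℂ conjℂ y
  conjℂ-+ (a , b) (c , d) = cong (a + c ,_) (sym (-‿+-comm b d))

  conjℂ-* : ∀ x y → conjℂ (x *ℂ y) ≡ conjℂ x *ℂ conjℂ y
  conjℂ-* (a , b) (c , d) = cong₂ _,_
    (cong (λ z → a * c + - z) (sym (-x*-y≡x*y b d)))
    (trans (sym (-‿+-comm (a * d) (b * c))) (cong₂ _+_ (-‿distribʳ-* a d) (-‿distribˡ-* b c)))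

  conjℂ-1 : conjℂ 1ℂ ≡ 1ℂ
  conjℂ-1 = cong (1ℝ ,_) -0#≈0#

  invℂ-2 : invℂ (1ℂ +ℂ 1ℂ) *ℂ (1ℂ +ℂ 1ℂ) ≡ 1ℂ
  invℂ-2 = trans (cong (λ s → invℂ (1ℝ + 1ℝ , s) *ℂ (1ℝ + 1ℝ , s)) (+-identityˡ 0ℝ))
                 (invℂ-inverseˡ-real (1ℝ + 1ℝ) 1+1≢0)

  NonNegℂ-+ : ∀ {x y} → NonNegℂ x → NonNegℂ y → NonNegℂ (x +ℂ y)
  NonNegℂ-+ (a≥0 , b≡0) (c≥0 , d≡0) = NonNeg-+ a≥0 c≥0 , trans (cong₂ _+_ b≡0 d≡0) (+-identityˡ 0ℝ)

  NonNegℂ-norm : ∀ z → NonNegℂ (z *ℂ conjℂ z)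
  NonNegℂ-norm (a , b) = subst NonNegℂ (sym (normℂ a b)) (NonNeg-+ (NonNeg-square a) (NonNeg-square b) , refl)

  NonNegℂ-+-zeroˡ : ∀ {x y} → NonNegℂ x → NonNegℂ y → x +ℂ y ≡ 0ℂ → x ≡ 0ℂ
  NonNegℂ-+-zeroˡ (a≥0 , b≡0) (c≥0 , _) x+y≡0 = cong₂ _,_ (NonNeg-+-zeroˡ a≥0 c≥0 (cong proj₁ x+y≡0)) b≡0

complexPositiveStarRing : (R : RealField) → IsPositiveStarRing (complexScalars R)
complexPositiveStarRing R = record
  { isCommutativeRing = isCommutativeRingℂ
  ; conj-+            = conjℂ-+
  ; conj-*            = conjℂ-*
  ; conj-1            = conjℂ-1
  ; inv-2             = invℂ-2
  ; NonNeg            = NonNegℂ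
  ; NonNeg-+          = NonNegℂ-+
  ; NonNeg-norm       = NonNegℂ-norm
  ; NonNeg-+-zeroˡ    = NonNegℂ-+-zeroˡ
  ; norm-zero         = normℂ-zero
  }
  where open ComplexNumbers R

positiveStarRing : (R : RealField) (κ : Kind) → IsPositiveStarRing (scalars R κ)
positiveStarRing R real    = realPositiveStarRing R
positiveStarRing R complex = complexPositiveStarRing R

mainTheorem5 : (R : RealField) (κ : Kind) (n N : ℕ) (Γ : Graph N)
    → GraphNotions.AcyclicOrientation Γ
    → GraphNotions.CliqueNumber≥3 Γ
    → (ρ : LinAlg.Representation (scalars R κ) n)
    → (A : Forms.Connection (scalars R κ) n Γ)
    → (D : Forms.TwoForm (scalars R κ) n Γ → Forms.OneForm (scalars R κ) n Γ)
    → Forms.IsAdjointOfd-A (scalars R κ) n Γ ρ A D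
    → (Forms.FirstVariationVanishes (scalars R κ) n Γ ρ A
         → Forms.YangMillsCondition (scalars R κ) n Γ ρ A D)
      × (Forms.YangMillsCondition (scalars R κ) n Γ ρ A D
         → Forms.FirstVariationVanishes (scalars R κ) n Γ ρ A)
mainTheorem5 R κ n N Γ _ _ ρ A =
  YangMills.firstVariationVanishes⇔yangMills (positiveStarRing R κ) n Γ ρ A
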